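{- In the setting described in the context (with $U_0$ a recurrent state and $v_1$ following an anti-threshold rule), let $x\in\{+1,-1\}$ and $t\ge0$. If $(c_{t+1},c_{t+2},c_{t+3},c_{t+4},c_{t+5})=(-x,x,x,-x,x)$, then $U_{t+6}=U_t$.
   Context: $G$ is a finite graph (loops allowed, no multiple edges) on vertex set $\{v_1,\dots,v_n\}$; $N_i$ is the neighbourhood of $v_i$ (including $v_i$ iff there is a loop at $v_i$). Each vertex holds an opinion in $\{+1,-1\}$; $U_t$ is the set of vertices with opinion $+1$ at time $t$. All vertices update simultaneously: $v_i\in U_{t+1}$ iff $N_i\cap U_t\in\mathcal S_i$, where for $i\ge2$, $\mathcal S_i=\{A\subseteq N_i:|A|\ge r_i\}$ (threshold rule, integer $r_i$), and $v_1$ follows an anti-threshold rule: $\mathcal S_1=\{A\subseteq N_1:|A|<r_1\}$ for some integer $r_1$. The initial state is recurrent: $U_p=U_0$ for some $p\ge1$. $c_t\in\{+1,-1\}$ denotes the opinion of $v_1$ at time $t$. -}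

module Defs where

open import Data.Nat using (ℕ; zero; suc)
open import Data.Integer using (ℤ; +_; _≤?_; _<?_)
open import Data.Bool using (Bool; true; false; _∧_)
open import Data.Fin using (Fin)
open import Data.List using (List; length; filterᵇ)
open import Data.List using (allFin) public
open import Relation.Nullary.Decidable using (⌊_⌋)
open import Relation.Binary.PropositionalEquality using (_≡_)

-- A finite graph on vertices Fin m (loops allowed, no multiple edges):
-- a symmetric Boolean adjacency relation.  adj i i ≡ true means a loop at i.
record Graph (m : ℕ) : Set where
  field
    adj : Fin m → Fin m → Bool
    sym : ∀ i j → adj i j ≡ adj j i
open Graph public

-- A state: the set U of vertices with opinion +1 (true = +1, false = -1).
State : ℕ → Set
State m = Fin m → Bool

count : ∀ {m} → Graph m → State m → Fin m → ℕ
count G U i = length (filterᵇ (λ j → adj G i j ∧ U j) (allFin _))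

-- Vertex v_1 is `Fin.zero` (of Fin (suc n)) and
-- follows the anti-threshold rule |N_1 ∩ U| < r_1; all others follow the
-- threshold rule |N_i ∩ U| ≥ r_i.
step : ∀ {n} → Graph (suc n) → (Fin (suc n) → ℤ) → State (suc n) → State (suc n)
step G r U Fin.zero    = ⌊ (+ count G U Fin.zero) <? r Fin.zero ⌋
step G r U (Fin.suc i) = ⌊ r (Fin.suc i) ≤? (+ count G U (Fin.suc i)) ⌋

run : ∀ {n} → Graph (suc n) → (Fin (suc n) → ℤ) → State (suc n) → ℕ → State (suc n)
run G r U0 zero    = U0
run G r U0 (suc t) = step G r (run G r U0 t)

_≐_ : ∀ {m} → State m → State m → Set
U ≐ V = ∀ i → U i ≡ V i

module Submission where

-- Treat the opinion of v₁ as an external input to the threshold vertices v₂ … vₙ.  The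
-- Goles–Olivos energy of two consecutive configurations does not decrease along the dynamics
-- and is periodic on a recurrent trajectory, hence constant.  So a threshold vertex whose
-- opinion at time s + 2 differs from that at time s is pivotal at time s + 1: it is adjacent
-- to v₁ and one vote short of its threshold without v₁, so it copies v₁.  Off v₁ this gives
-- U_s ⊆ U_{s+2} when c_{s+1} = +1 and U_{s+2} ⊆ U_s when c_{s+1} = −1.  For x = +1 these
-- inclusions, combined with the anti-threshold inequalities at v₁, give U_{t+6} = U_t off v₁
-- and force a loop at v₁ with c_t = +1; and c_{t+6} = −1 would force U_{t−1} = U_{t+1}, hence
-- U_t = U_{t+2}, contradicting c_{t+1} ≠ c_{t+3}.  Flipping every opinion turns the network
-- into one of the same kind, with thresholds 1 + deg − r, and exchanges x = +1 with x = −1.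

open import Defs hiding (sym)
open import Data.Bool using (Bool; true; false; not; _∧_; _≟_)
open import Data.Bool.Properties using (not-injective; ¬-not; ∧-zeroʳ)
open import Data.Fin using (Fin; zero; suc)
open import Data.Product using (Σ; _×_; _,_; proj₁; proj₂)
open import Data.Sum using (_⊎_; inj₁; inj₂; [_,_]′)
open import Relation.Binary.PropositionalEquality
open import Function using (_∘_)
open import Data.Empty using (⊥)

module ContrarianDynamics where
  open import Data.Nat as ℕ using (ℕ; suc)
  import Data.Nat.Properties as ℕ
  open import Data.List using (length; filterᵇ; tabulate)
  open import Data.Integer using (ℤ; +_; 0ℤ; 1ℤ; -_; _+_; _-_; _*_; _≤_; _<_; +≤+; +<+; _≤?_; _<?_)
  open import Data.Integer.Properties hiding (_≟_)
  open import Data.Integer.Tactic.RingSolver using (solve-∀)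
  open import Data.Nat.Tactic.RingSolver using () renaming (solve-∀ to ℕ-solve-∀)
  open import Algebra.Properties.AbelianGroup +-0-abelianGroup using (identityʳ-unique)
  open import Algebra.Properties.Semiring.Sum +-*-semiring
    using (sum; sum-syntax; sum-replicate-zero; sum-cong-≗; ∑-distrib-+; ∑-comm; *-distribˡ-sum)
  open import Relation.Nullary using (Dec; yes; no; ¬_; contradiction)
  open import Relation.Nullary.Decidable using (⌊_⌋; isYes≗does; dec-true; dec-false)

  true≢false : true ≢ false
  true≢false ()

  𝟙 : Bool → ℤ
  𝟙 true  = 1ℤ
  𝟙 false = 0ℤ

  𝟙-nonneg : ∀ b → 0ℤ ≤ 𝟙 b
  𝟙-nonneg true  = +≤+ ℕ.z≤n
  𝟙-nonneg false = +≤+ ℕ.z≤n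

  𝟙-≤1 : ∀ b → 𝟙 b ≤ 1ℤ
  𝟙-≤1 true  = ≤-refl
  𝟙-≤1 false = +≤+ ℕ.z≤n

  𝟙-∧ : ∀ a b → 𝟙 (a ∧ b) ≡ 𝟙 a * 𝟙 b
  𝟙-∧ true  true  = refl
  𝟙-∧ true  false = refl
  𝟙-∧ false b     = refl

  𝟙-∧-split : ∀ a c → 𝟙 (a ∧ c) + 𝟙 (a ∧ not c) ≡ 𝟙 a
  𝟙-∧-split true  true  = refl
  𝟙-∧-split true  false = refl
  𝟙-∧-split false c     = refl

  𝟙-∧-mono : ∀ a {b c} → (b ≡ true → c ≡ true) → 𝟙 (a ∧ b) ≤ 𝟙 (a ∧ c)
  𝟙-∧-mono false _ = ≤-refl
  𝟙-∧-mono true {false} {c} _ = 𝟙-nonneg c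
  𝟙-∧-mono true {true} b⇒c rewrite b⇒c refl = ≤-refl

  module _ {A : Set} where

    ⌊⌋-true⁻¹ : (a? : Dec A) → ⌊ a? ⌋ ≡ true → A
    ⌊⌋-true⁻¹ (yes a) _ = a
    ⌊⌋-true⁻¹ (no _)  ()

    ⌊⌋-false⁻¹ : (a? : Dec A) → ⌊ a? ⌋ ≡ false → ¬ A
    ⌊⌋-false⁻¹ (yes _)  ()
    ⌊⌋-false⁻¹ (no ¬a) _ = ¬a

    ⌊⌋-true : (a? : Dec A) → A → ⌊ a? ⌋ ≡ true
    ⌊⌋-true a? a = trans (isYes≗does a?) (dec-true a? a)

    ⌊⌋-false : (a? : Dec A) → ¬ A → ⌊ a? ⌋ ≡ false
    ⌊⌋-false a? ¬a = trans (isYes≗does a?) (dec-false a? ¬a)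

  ⌊⌋-complement : ∀ {A B : Set} (a? : Dec A) (b? : Dec B) → (A → ¬ B) → (¬ B → A) → ⌊ a? ⌋ ≡ not ⌊ b? ⌋
  ⌊⌋-complement (yes a)  (yes b) A⇒¬B _    = contradiction b (A⇒¬B a)
  ⌊⌋-complement (yes _)  (no _)  _    _    = refl
  ⌊⌋-complement (no _)   (yes _) _    _    = refl
  ⌊⌋-complement (no ¬a)  (no ¬b) _    ¬B⇒A = contradiction (¬B⇒A ¬b) ¬a

  sum-mono-≤ : ∀ {m} {f g : Fin m → ℤ} → (∀ i → f i ≤ g i) → sum f ≤ sum g
  sum-mono-≤ {ℕ.zero} f≤g = ≤-refl
  sum-mono-≤ {suc m}  f≤g = +-mono-≤ (f≤g zero) (sum-mono-≤ (λ i → f≤g (suc i)))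

  sum-mono-< : ∀ {m} {f g : Fin m → ℤ} → (∀ i → f i ≤ g i) → ∀ k → f k < g k → sum f < sum g
  sum-mono-< f≤g zero    fk<gk = +-mono-<-≤ fk<gk (sum-mono-≤ (λ i → f≤g (suc i)))
  sum-mono-< f≤g (suc k) fk<gk = +-mono-≤-< (f≤g zero) (sum-mono-< (λ i → f≤g (suc i)) k fk<gk)

  sum-nonneg : ∀ {m} {f : Fin m → ℤ} → (∀ i → 0ℤ ≤ f i) → 0ℤ ≤ sum f
  sum-nonneg {m} {f} 0≤f = subst (_≤ sum f) (sum-replicate-zero m) (sum-mono-≤ 0≤f)

  nonneg-sum≡0 : ∀ {m} {f : Fin m → ℤ} → (∀ i → 0ℤ ≤ f i) → sum f ≡ 0ℤ → ∀ i → f i ≡ 0ℤ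
  nonneg-sum≡0 {m} {f} 0≤f ∑f≡0 i = ≤-antisym (≮⇒≥ 0≮fi) (0≤f i)
    where
    0≮fi : ¬ (0ℤ < f i)
    0≮fi 0<fi = <-irrefl (trans (sum-replicate-zero m) (sym ∑f≡0)) (sum-mono-< 0≤f i 0<fi)

  length-filter-tabulate : ∀ {A : Set} {m} (g : Fin m → A) (p : A → Bool) →
                           + length (filterᵇ p (tabulate g)) ≡ ∑[ j < m ] 𝟙 (p (g j))
  length-filter-tabulate {m = ℕ.zero} g p = refl
  length-filter-tabulate {m = suc m}  g p with p (g zero)
  ... | true  = cong (_+_ 1ℤ) (length-filter-tabulate (λ j → g (suc j)) p)
  ... | false = trans (length-filter-tabulate (λ j → g (suc j)) p) (sym (+-identityˡ _))

  module _ (f : ℕ → ℤ) (nondecreasing : ∀ s → f s ≤ f (suc s)) where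

    nondecreasing-+ : ∀ s k → f s ≤ f (k ℕ.+ s)
    nondecreasing-+ s ℕ.zero  = ≤-refl
    nondecreasing-+ s (suc k) = ≤-trans (nondecreasing-+ s k) (nondecreasing (k ℕ.+ s))

    periodic-nondecreasing-constant : ∀ q → (∀ s → f (suc q ℕ.+ s) ≡ f s) → ∀ s → f (suc s) ≡ f s
    periodic-nondecreasing-constant q periodic s = ≤-antisym (begin
      f (suc s)           ≤⟨ nondecreasing-+ (suc s) q ⟩
      f (q ℕ.+ suc s)     ≡⟨ cong f (ℕ.+-suc q s) ⟩
      f (suc q ℕ.+ s)     ≡⟨ periodic s ⟩
      f s                 ∎) (nondecreasing s)
      where open ≤-Reasoning

  nonneg-double-plus : ∀ {D k} → 0ℤ ≤ D → 0ℤ ≤ k → 0ℤ ≤ + 2 * D + k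
  nonneg-double-plus 0≤D 0≤k = +-mono-≤ (*-monoˡ-≤-nonNeg (+ 2) 0≤D) 0≤k

  double-plus≡0 : ∀ {D k} → 0ℤ ≤ D → 0ℤ ≤ k → + 2 * D + k ≡ 0ℤ → D ≡ 0ℤ × k ≡ 0ℤ
  double-plus≡0 {+ d} {+ k} _ _ eq =
    cong +_ (ℕ.m+n≡0⇒m≡0 d (ℕ.m+n≡0⇒m≡0 (2 ℕ.* d) 2d+k≡0)) , cong +_ (ℕ.m+n≡0⇒n≡0 (2 ℕ.* d) 2d+k≡0)
    where
    2d+k≡0 : 2 ℕ.* d ℕ.+ k ≡ 0
    2d+k≡0 = +-injective (trans (cong (_+ + k) (pos-* 2 d)) eq)

  reversed-≤ : ∀ D {c ρ} → ρ ≤ c → D - c < 1ℤ + (D - ρ)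
  reversed-≤ D ρ≤c = suc[i]≤j⇒i<j (+-monoʳ-≤ 1ℤ (+-monoʳ-≤ D (neg-mono-≤ ρ≤c)))

  reversed-< : ∀ D {c ρ} → c < ρ → 1ℤ + (D - ρ) ≤ D - c
  reversed-< D {c} {ρ} c<ρ = begin
    1ℤ + (D - ρ)             ≤⟨ +-monoʳ-≤ 1ℤ (+-monoʳ-≤ D (neg-mono-≤ (i<j⇒suc[i]≤j c<ρ))) ⟩
    1ℤ + (D - (1ℤ + c))      ≡⟨ identity D c ⟩
    D - c                    ∎
    where
    open ≤-Reasoning
    identity : ∀ D c → 1ℤ + (D - (1ℤ + c)) ≡ D - c
    identity = solve-∀

  -- 2 (C + a/2 − ρ) + 1: v₁'s vote, which is 0 or a, is replaced by the midpoint a/2, so the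
  -- sign is right whichever opinion v₁ holds.
  localField : Bool → ℤ → ℤ → ℤ
  localField a C ρ = + 2 * C + (1ℤ + 𝟙 a - + 2 * ρ)

  slack : Bool → Bool → ℤ
  slack a c = 1ℤ + 𝟙 a - + 2 * 𝟙 (a ∧ c)

  slack-nonneg : ∀ a c → 0ℤ ≤ slack a c
  slack-nonneg false c     = +≤+ ℕ.z≤n
  slack-nonneg true  true  = +≤+ ℕ.z≤n
  slack-nonneg true  false = +≤+ ℕ.z≤n

  slack≡0 : ∀ a c → slack a c ≡ 0ℤ → a ≡ true × c ≡ true
  slack≡0 true true _ = refl , refl

  localField-above : ∀ a c C ρ → localField a C ρ ≡ + 2 * (𝟙 (a ∧ c) + C - ρ) + slack a c
  localField-above a c C ρ = identity C ρ (𝟙 a) (𝟙 (a ∧ c))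
    where
    identity : ∀ C ρ A P → + 2 * C + (1ℤ + A - + 2 * ρ) ≡ + 2 * (P + C - ρ) + (1ℤ + A - + 2 * P)
    identity = solve-∀

  localField-below : ∀ a c C ρ → - localField a C ρ ≡ + 2 * (ρ - (1ℤ + (𝟙 (a ∧ c) + C))) + slack a (not c)
  localField-below a c C ρ =
    subst (λ A → - (+ 2 * C + (1ℤ + A - + 2 * ρ)) ≡ + 2 * (ρ - (1ℤ + (P + C))) + (1ℤ + A - + 2 * Q))
          (𝟙-∧-split a c) (identity C ρ P Q)
    where
    P = 𝟙 (a ∧ c)
    Q = 𝟙 (a ∧ not c)
    identity : ∀ C ρ P Q → - (+ 2 * C + (1ℤ + (P + Q) - + 2 * ρ)) ≡
                           + 2 * (ρ - (1ℤ + (P + C))) + (1ℤ + (P + Q) - + 2 * Q)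
    identity = solve-∀

  localField-nonneg : ∀ a c {C ρ} → ρ ≤ 𝟙 (a ∧ c) + C → 0ℤ ≤ localField a C ρ
  localField-nonneg a c {C} {ρ} ρ≤T = subst (0ℤ ≤_) (sym (localField-above a c C ρ))
    (nonneg-double-plus (i≤j⇒0≤j-i ρ≤T) (slack-nonneg a c))

  localField-nonpos : ∀ a c {C ρ} → 𝟙 (a ∧ c) + C < ρ → 0ℤ ≤ - localField a C ρ
  localField-nonpos a c {C} {ρ} T<ρ = subst (0ℤ ≤_) (sym (localField-below a c C ρ))
    (nonneg-double-plus (i≤j⇒0≤j-i (i<j⇒suc[i]≤j T<ρ)) (slack-nonneg a (not c)))

  localField≡0-above : ∀ a c {C ρ} → ρ ≤ 𝟙 (a ∧ c) + C → localField a C ρ ≡ 0ℤ → a ≡ true × ρ ≡ 1ℤ + C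
  localField≡0-above a c {C} {ρ} ρ≤T F≡0
    with double-plus≡0 (i≤j⇒0≤j-i ρ≤T) (slack-nonneg a c) (trans (sym (localField-above a c C ρ)) F≡0)
  ... | D≡0 , slack≡0′ with slack≡0 a c slack≡0′
  ... | refl , refl = refl , sym (i-j≡0⇒i≡j _ _ D≡0)

  localField≡0-below : ∀ a c {C ρ} → 𝟙 (a ∧ c) + C < ρ → - localField a C ρ ≡ 0ℤ → a ≡ true × ρ ≡ 1ℤ + C
  localField≡0-below a c {C} {ρ} T<ρ F≡0
    with double-plus≡0 (i≤j⇒0≤j-i (i<j⇒suc[i]≤j T<ρ)) (slack-nonneg a (not c))
                       (trans (sym (localField-below a c C ρ)) F≡0)
  ... | D≡0 , slack≡0′ with slack≡0 a (not c) slack≡0′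
  ... | refl , ¬c≡true with not-injective {c} {false} ¬c≡true
  ... | refl = refl , trans (i-j≡0⇒i≡j _ _ D≡0) (cong (_+_ 1ℤ) (+-identityˡ C))

  module Network {n : ℕ} (G : Graph (suc n)) (r : Fin (suc n) → ℤ) where

    Config : Set
    Config = State (suc n)

    votes : Config → Fin (suc n) → ℤ
    votes U i = + count G U i

    votes′ : Config → Fin (suc n) → ℤ
    votes′ U i = ∑[ k < n ] 𝟙 (adj G i (suc k) ∧ U (suc k))

    votes-split : ∀ U i → votes U i ≡ 𝟙 (adj G i zero ∧ U zero) + votes′ U i
    votes-split U i = length-filter-tabulate (λ j → j) (λ j → adj G i j ∧ U j)

    _⊆_ : Config → Config → Set
    U ⊆ V = ∀ i → U i ≡ true → V i ≡ true

    record _⊆′_ (U V : Config) : Set where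
      constructor mk⊆′
      field ⊆′-apply : ∀ k → U (suc k) ≡ true → V (suc k) ≡ true
    open _⊆′_

    ⊆′-refl : ∀ {U} → U ⊆′ U
    ⊆′-refl = mk⊆′ λ _ on → on

    ⊆′-trans : ∀ {U V W} → U ⊆′ V → V ⊆′ W → U ⊆′ W
    ⊆′-trans U⊆V V⊆W = mk⊆′ λ k on → ⊆′-apply V⊆W k (⊆′-apply U⊆V k on)

    ⊆′-antisym : ∀ {U V} → U ⊆′ V → V ⊆′ U → ∀ k → U (suc k) ≡ V (suc k)
    ⊆′-antisym {U} {V} U⊆V V⊆U k with U (suc k) in Uₖ | V (suc k) in Vₖ
    ... | true  | true  = refl
    ... | false | false = refl
    ... | true  | false = sym (trans (sym Vₖ) (⊆′-apply U⊆V k Uₖ))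
    ... | false | true  = trans (sym Uₖ) (⊆′-apply V⊆U k Vₖ)

    ⊆⇒⊆′ : ∀ {U V} → U ⊆ V → U ⊆′ V
    ⊆⇒⊆′ U⊆V = mk⊆′ λ k → U⊆V (suc k)

    votes′-mono : ∀ {U V} → U ⊆′ V → ∀ i → votes′ U i ≤ votes′ V i
    votes′-mono U⊆V i = sum-mono-≤ (λ k → 𝟙-∧-mono (adj G i (suc k)) (⊆′-apply U⊆V k))

    votes′-mono-< : ∀ {U V} → U ⊆′ V → ∀ i k → adj G i (suc k) ≡ true →
                    U (suc k) ≡ false → V (suc k) ≡ true → votes′ U i < votes′ V i
    votes′-mono-< {V = V} U⊆V i k iₖ Uₖ Vₖ =
      sum-mono-< (λ j → 𝟙-∧-mono (adj G i (suc j)) (⊆′-apply U⊆V j)) k (subst₂ (λ a b → 𝟙 (a ∧ b) < 𝟙 (a ∧ V (suc k))) (sym iₖ) (sym Uₖ)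
        (subst (λ b → 0ℤ < 𝟙 b) (sym Vₖ) (+<+ (ℕ.s≤s ℕ.z≤n))))

    votes′-cong : ∀ {U V} → (∀ k → U (suc k) ≡ V (suc k)) → ∀ i → votes′ U i ≡ votes′ V i
    votes′-cong U≐V i = sum-cong-≗ (λ k → cong (λ b → 𝟙 (adj G i (suc k) ∧ b)) (U≐V k))

    votes-cong : ∀ {U V} → U ≐ V → ∀ i → votes U i ≡ votes V i
    votes-cong {U} {V} U≐V i = begin
      votes U i                                 ≡⟨ votes-split U i ⟩
      𝟙 (adj G i zero ∧ U zero) + votes′ U i    ≡⟨ cong₂ (λ b v → 𝟙 (adj G i zero ∧ b) + v)
                                                         (U≐V zero) (votes′-cong {U} {V} (U≐V ∘ suc) i) ⟩
      𝟙 (adj G i zero ∧ V zero) + votes′ V i    ≡⟨ sym (votes-split V i) ⟩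
      votes V i                                 ∎
      where open ≡-Reasoning

    votes≤1+votes′ : ∀ U i → votes U i ≤ 1ℤ + votes′ U i
    votes≤1+votes′ U i = begin
      votes U i                                ≡⟨ votes-split U i ⟩
      𝟙 (adj G i zero ∧ U zero) + votes′ U i   ≤⟨ +-monoˡ-≤ (votes′ U i) (𝟙-≤1 (adj G i zero ∧ U zero)) ⟩
      1ℤ + votes′ U i                          ∎
      where open ≤-Reasoning

    votes-when-off : ∀ U i → U zero ≡ false → votes U i ≡ votes′ U i
    votes-when-off U i U₁ = begin
      votes U i                                ≡⟨ votes-split U i ⟩
      𝟙 (adj G i zero ∧ U zero) + votes′ U i   ≡⟨ cong (λ b → 𝟙 (adj G i zero ∧ b) + votes′ U i) U₁ ⟩
      𝟙 (adj G i zero ∧ false) + votes′ U i    ≡⟨ cong (λ b → 𝟙 b + votes′ U i) (∧-zeroʳ (adj G i zero)) ⟩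
      0ℤ + votes′ U i                          ≡⟨ +-identityˡ _ ⟩
      votes′ U i                               ∎
      where open ≡-Reasoning

    votes-when-on : ∀ U i → adj G i zero ≡ true → U zero ≡ true → votes U i ≡ 1ℤ + votes′ U i
    votes-when-on U i i₁ U₁ =
      trans (votes-split U i) (cong₂ (λ a b → 𝟙 (a ∧ b) + votes′ U i) i₁ U₁)

    votes-mono : ∀ {U V} → U ⊆ V → ∀ i → votes U i ≤ votes V i
    votes-mono {U} {V} U⊆V i = begin
      votes U i                                ≡⟨ votes-split U i ⟩
      𝟙 (adj G i zero ∧ U zero) + votes′ U i   ≤⟨ +-mono-≤ (𝟙-∧-mono (adj G i zero) (U⊆V zero))
                                                           (votes′-mono (⊆⇒⊆′ U⊆V) i) ⟩
      𝟙 (adj G i zero ∧ V zero) + votes′ V i   ≡⟨ sym (votes-split V i) ⟩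
      votes V i                                ∎
      where open ≤-Reasoning

    ⊆′-tight : ∀ {U V} → U ⊆′ V → ∀ i → votes′ V i < 1ℤ + votes′ U i →
               ∀ k → adj G i (suc k) ≡ true → V (suc k) ≡ true → U (suc k) ≡ true
    ⊆′-tight U⊆V i V<1+U k iₖ Vₖ = ¬-not λ Uₖ →
      <⇒≱ V<1+U (i<j⇒suc[i]≤j (votes′-mono-< U⊆V i k iₖ Uₖ Vₖ))

    v₁-counted : ∀ U i → votes′ U i < votes U i → adj G i zero ≡ true × U zero ≡ true
    v₁-counted U i lt = counted (adj G i zero) (U zero) (subst (votes′ U i <_) (votes-split U i) lt)
      where
      counted : ∀ a b → votes′ U i < 𝟙 (a ∧ b) + votes′ U i → a ≡ true × b ≡ true
      counted true  true  _  = refl , refl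
      counted true  false lt = contradiction lt (<-irrefl (sym (+-identityˡ _)))
      counted false b     lt = contradiction lt (<-irrefl (sym (+-identityˡ _)))

    step-v₁-on : ∀ U → step G r U zero ≡ true → votes U zero < r zero
    step-v₁-on U = ⌊⌋-true⁻¹ (votes U zero <? r zero)

    step-v₁-off : ∀ U → step G r U zero ≡ false → r zero ≤ votes U zero
    step-v₁-off U off = ≮⇒≥ (⌊⌋-false⁻¹ (votes U zero <? r zero) off)

    step-on : ∀ U k → r (suc k) ≤ votes U (suc k) → step G r U (suc k) ≡ true
    step-on U k = ⌊⌋-true (r (suc k) ≤? votes U (suc k))

    step-off : ∀ U k → votes U (suc k) < r (suc k) → step G r U (suc k) ≡ false
    step-off U k below = ⌊⌋-false (r (suc k) ≤? votes U (suc k)) (<⇒≱ below)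

    step-on⁻¹ : ∀ U k → step G r U (suc k) ≡ true → r (suc k) ≤ votes U (suc k)
    step-on⁻¹ U k = ⌊⌋-true⁻¹ (r (suc k) ≤? votes U (suc k))

    step-cong : ∀ {U V} → U ≐ V → step G r U ≐ step G r V
    step-cong U≐V zero    = cong (λ v → ⌊ v <? r zero ⌋) (votes-cong U≐V zero)
    step-cong U≐V (suc k) = cong (λ v → ⌊ r (suc k) ≤? v ⌋) (votes-cong U≐V (suc k))

    step-mono : ∀ {U V} → U ⊆ V → step G r U ⊆′ step G r V
    step-mono {U} {V} U⊆V = mk⊆′ λ k on →
      step-on V k (≤-trans (step-on⁻¹ U k on) (votes-mono U⊆V (suc k)))

    run-cong : ∀ {U V} → U ≐ V → ∀ s → run G r U s ≐ run G r V s
    run-cong U≐V ℕ.zero  = U≐V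
    run-cong U≐V (suc s) = step-cong (run-cong U≐V s)

    run-+ : ∀ U s p → run G r U (s ℕ.+ p) ≐ run G r (run G r U p) s
    run-+ U ℕ.zero  p i = refl
    run-+ U (suc s) p   = step-cong (run-+ U s p)

    Pivotal : Config → Fin n → Set
    Pivotal U k = adj G (suc k) zero ≡ true × r (suc k) ≡ 1ℤ + votes′ U (suc k)

    pivotal-up : ∀ {U V k} → Pivotal U k → U ⊆′ V → V zero ≡ true → step G r V (suc k) ≡ true
    pivotal-up {U} {V} {k} (k₁ , rₖ) U⊆V V₁ = step-on V k (begin
      r (suc k)               ≡⟨ rₖ ⟩
      1ℤ + votes′ U (suc k)   ≤⟨ +-monoʳ-≤ 1ℤ (votes′-mono U⊆V (suc k)) ⟩
      1ℤ + votes′ V (suc k)   ≡⟨ sym (votes-when-on V (suc k) k₁ V₁) ⟩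
      votes V (suc k)         ∎)
      where open ≤-Reasoning

    pivotal-down : ∀ {U V k} → Pivotal U k → V ⊆′ U → V zero ≡ false → step G r V (suc k) ≡ false
    pivotal-down {U} {V} {k} (_ , rₖ) V⊆U V₁ = step-off V k (begin-strict
      votes V (suc k)         ≡⟨ votes-when-off V (suc k) V₁ ⟩
      votes′ V (suc k)        ≤⟨ votes′-mono V⊆U (suc k) ⟩
      votes′ U (suc k)        <⟨ suc[i]≤j⇒i<j ≤-refl ⟩
      1ℤ + votes′ U (suc k)   ≡⟨ sym rₖ ⟩
      r (suc k)               ∎)
      where open ≤-Reasoning

    pivotal-follows-v₁ : ∀ {U k} → Pivotal U k → step G r U (suc k) ≡ U zero
    pivotal-follows-v₁ {U} {k} p = follows (U zero) refl
      where
      follows : ∀ b → U zero ≡ b → step G r U (suc k) ≡ b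
      follows true  U₁ = pivotal-up p ⊆′-refl U₁
      follows false U₁ = pivotal-down p ⊆′-refl U₁

    step-on⇒above : ∀ U k → step G r U (suc k) ≡ true →
                    r (suc k) ≤ 𝟙 (adj G (suc k) zero ∧ U zero) + votes′ U (suc k)
    step-on⇒above U k on = subst (r (suc k) ≤_) (votes-split U (suc k)) (step-on⁻¹ U k on)

    step-off⇒below : ∀ U k → step G r U (suc k) ≡ false →
                     𝟙 (adj G (suc k) zero ∧ U zero) + votes′ U (suc k) < r (suc k)
    step-off⇒below U k off =
      subst (_< r (suc k)) (votes-split U (suc k)) (≰⇒> (⌊⌋-false⁻¹ (r (suc k) ≤? votes U (suc k)) off))

    fieldAt : Config → Fin n → ℤ
    fieldAt U k = localField (adj G (suc k) zero) (votes′ U (suc k)) (r (suc k))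

    gain : Bool → Config → Fin n → ℤ
    gain b U k = (𝟙 (step G r U (suc k)) - 𝟙 b) * fieldAt U k

    gain-nonneg : ∀ b U k → 0ℤ ≤ gain b U k
    gain-nonneg b U k with step G r U (suc k) in Uₖ | b
    ... | true  | true  = ≤-refl
    ... | false | false = ≤-refl
    ... | true  | false = subst (0ℤ ≤_) (sym (*-identityˡ _))
      (localField-nonneg (adj G (suc k) zero) (U zero) (step-on⇒above U k Uₖ))
    ... | false | true  = subst (0ℤ ≤_) (sym (-1*i≡-i _))
      (localField-nonpos (adj G (suc k) zero) (U zero) (step-off⇒below U k Uₖ))

    gain≡0 : ∀ b U k → gain b U k ≡ 0ℤ → step G r U (suc k) ≢ b → Pivotal U k
    gain≡0 b U k g≡0 changed with step G r U (suc k) in Uₖ | b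
    ... | true  | true  = contradiction refl changed
    ... | false | false = contradiction refl changed
    ... | true  | false = localField≡0-above (adj G (suc k) zero) (U zero)
      (step-on⇒above U k Uₖ) (trans (sym (*-identityˡ _)) g≡0)
    ... | false | true  = localField≡0-below (adj G (suc k) zero) (U zero)
      (step-off⇒below U k Uₖ) (trans (sym (-1*i≡-i _)) g≡0)

    -- The Goles–Olivos energy of the threshold vertices; v₁ enters only through the constant β.
    y : Config → Fin n → ℤ
    y U k = 𝟙 (U (suc k))

    β : Fin n → ℤ
    β k = 1ℤ + 𝟙 (adj G (suc k) zero) - + 2 * r (suc k)

    A : Fin n → Fin n → ℤ
    A k j = 𝟙 (adj G (suc k) (suc j))

    pot : Config → Config → ℤ
    pot U V = ∑[ k < n ] (y V k * fieldAt U k)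

    bias : Config → ℤ
    bias U = ∑[ k < n ] (β k * y U k)

    coupling : Config → Config → ℤ
    coupling U V = ∑[ k < n ] ∑[ j < n ] (A k j * (y U k * y V j))

    energy : Config → Config → ℤ
    energy U V = pot U V + bias U

    coupling-sym : ∀ U V → coupling U V ≡ coupling V U
    coupling-sym U V = trans (∑-comm (λ k j → A k j * (y U k * y V j)))
      (sum-cong-≗ λ j → sum-cong-≗ λ k →
        cong₂ (λ a p → 𝟙 a * p) (Graph.sym G (suc k) (suc j)) (*-comm (y U k) (y V j)))

    pot-expand : ∀ U V → pot U V ≡ + 2 * coupling V U + bias V
    pot-expand U V = begin
      ∑[ k < n ] (y V k * fieldAt U k)
        ≡⟨ sum-cong-≗ (λ k → split (y V k) (votes′ U (suc k)) (β k)) ⟩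
      ∑[ k < n ] (+ 2 * (y V k * votes′ U (suc k)) + β k * y V k)
        ≡⟨ ∑-distrib-+ (λ k → + 2 * (y V k * votes′ U (suc k))) (λ k → β k * y V k) ⟩
      ∑[ k < n ] (+ 2 * (y V k * votes′ U (suc k))) + bias V
        ≡⟨ cong (_+ bias V) (sym (*-distribˡ-sum (+ 2) (λ k → y V k * votes′ U (suc k)))) ⟩
      + 2 * ∑[ k < n ] (y V k * votes′ U (suc k)) + bias V
        ≡⟨ cong (λ x → + 2 * x + bias V) (sum-cong-≗ λ k → trans
             (cong (y V k *_) (sum-cong-≗ λ j → 𝟙-∧ (adj G (suc k) (suc j)) (U (suc j))))
             (trans (*-distribˡ-sum (y V k) (λ j → A k j * y U j))
                    (sum-cong-≗ λ j → regroup (y V k) (A k j) (y U j)))) ⟩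
      + 2 * coupling V U + bias V
        ∎
      where
      open ≡-Reasoning
      split : ∀ x C b → x * (+ 2 * C + b) ≡ + 2 * (x * C) + b * x
      split = solve-∀
      regroup : ∀ x a z → x * (a * z) ≡ a * (x * z)
      regroup = solve-∀

    energy-sym : ∀ U V → energy U V ≡ energy V U
    energy-sym U V = begin
      pot U V + bias U                          ≡⟨ cong (_+ bias U) (pot-expand U V) ⟩
      + 2 * coupling V U + bias V + bias U      ≡⟨ cong (λ c → + 2 * c + bias V + bias U) (coupling-sym V U) ⟩
      + 2 * coupling U V + bias V + bias U      ≡⟨ swap (+ 2 * coupling U V) (bias V) (bias U) ⟩
      + 2 * coupling U V + bias U + bias V      ≡⟨ cong (_+ bias V) (sym (pot-expand V U)) ⟩
      pot V U + bias V                          ∎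
      where
      open ≡-Reasoning
      swap : ∀ a b c → a + b + c ≡ a + c + b
      swap = solve-∀

    energy-cong : ∀ {U U′ V V′} → U ≐ U′ → V ≐ V′ → energy U V ≡ energy U′ V′
    energy-cong {U} {U′} U≐U′ V≐V′ = cong₂ _+_
      (sum-cong-≗ λ k → cong₂ (λ b C → 𝟙 b * localField (adj G (suc k) zero) C (r (suc k)))
                               (V≐V′ (suc k)) (votes′-cong {U} {U′} (U≐U′ ∘ suc) (suc k)))
      (sum-cong-≗ λ k → cong (λ b → β k * 𝟙 b) (U≐U′ (suc k)))

    pot-update : ∀ U V W → pot V U + ∑[ k < n ] ((y W k - y U k) * fieldAt V k) ≡ pot V W
    pot-update U V W = trans
      (sym (∑-distrib-+ (λ k → y U k * fieldAt V k) (λ k → (y W k - y U k) * fieldAt V k)))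
      (sum-cong-≗ λ k → identity (y U k) (y W k) (fieldAt V k))
      where
      identity : ∀ u w f → u * f + (w - u) * f ≡ w * f
      identity = solve-∀

    module Recurrent (U0 : Config) (q : ℕ) (recurrent : run G r U0 (suc q) ≐ U0) where

      R : ℕ → Config
      R = run G r U0

      R-periodic : ∀ s → R (suc q ℕ.+ s) ≐ R s
      R-periodic s i = begin
        R (suc q ℕ.+ s) i            ≡⟨ cong (λ m → R m i) (ℕ.+-comm (suc q) s) ⟩
        R (s ℕ.+ suc q) i            ≡⟨ run-+ U0 s (suc q) i ⟩
        run G r (R (suc q)) s i      ≡⟨ run-cong recurrent s i ⟩
        R s i                        ∎
        where open ≡-Reasoning

      E : ℕ → ℤ
      E s = energy (R s) (R (suc s))

      gainAt : ℕ → Fin n → ℤ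
      gainAt s k = gain (R s (suc k)) (R (suc s)) k

      E-step : ∀ s → E s + ∑[ k < n ] gainAt s k ≡ E (suc s)
      E-step s = begin
        energy (R s) (R (suc s)) + ∑[ k < n ] gainAt s k
          ≡⟨ cong (_+ ∑[ k < n ] gainAt s k) (energy-sym (R s) (R (suc s))) ⟩
        pot (R (suc s)) (R s) + bias (R (suc s)) + ∑[ k < n ] gainAt s k
          ≡⟨ swap (pot (R (suc s)) (R s)) (bias (R (suc s))) (∑[ k < n ] gainAt s k) ⟩
        pot (R (suc s)) (R s) + ∑[ k < n ] gainAt s k + bias (R (suc s))
          ≡⟨ cong (_+ bias (R (suc s))) (pot-update (R s) (R (suc s)) (R (suc (suc s)))) ⟩
        energy (R (suc s)) (R (suc (suc s)))
          ∎
        where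
        open ≡-Reasoning
        swap : ∀ a b c → a + b + c ≡ a + c + b
        swap = solve-∀

      E-nondecreasing : ∀ s → E s ≤ E (suc s)
      E-nondecreasing s = subst₂ _≤_ (+-identityʳ (E s)) (E-step s)
        (+-monoʳ-≤ (E s) (sum-nonneg λ k → gain-nonneg (R s (suc k)) (R (suc s)) k))

      E-periodic : ∀ s → E (suc q ℕ.+ s) ≡ E s
      E-periodic s = energy-cong (R-periodic s) (step-cong (R-periodic s))

      gains-vanish : ∀ s → ∑[ k < n ] gainAt s k ≡ 0ℤ
      gains-vanish s = identityʳ-unique (E s) _
        (trans (E-step s) (periodic-nondecreasing-constant E E-nondecreasing q E-periodic s))

      pivotal : ∀ s k → R (2 ℕ.+ s) (suc k) ≢ R s (suc k) → Pivotal (R (suc s)) k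
      pivotal s k = gain≡0 (R s (suc k)) (R (suc s)) k
        (nonneg-sum≡0 (λ j → gain-nonneg (R s (suc j)) (R (suc s)) j) (gains-vanish s) k)

      stable-or-pivotal : ∀ s k → R (2 ℕ.+ s) (suc k) ≡ R s (suc k) ⊎ Pivotal (R (suc s)) k
      stable-or-pivotal s k with R (2 ℕ.+ s) (suc k) ≟ R s (suc k)
      ... | yes stable  = inj₁ stable
      ... | no  changed = inj₂ (pivotal s k changed)

      grows-when-v₁-on : ∀ s → R (suc s) zero ≡ true → R s ⊆′ R (2 ℕ.+ s)
      grows-when-v₁-on s v₁-on = mk⊆′ λ k on →
        [ (λ stable → trans stable on) , (λ p → trans (pivotal-follows-v₁ p) v₁-on) ]′ (stable-or-pivotal s k)

      shrinks-when-v₁-off : ∀ s → R (suc s) zero ≡ false → R (2 ℕ.+ s) ⊆′ R s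
      shrinks-when-v₁-off s v₁-off = mk⊆′ λ k on →
        [ (λ stable → trans (sym stable) on)
        , (λ p → contradiction (trans (sym on) (trans (pivotal-follows-v₁ p) v₁-off)) true≢false)
        ]′ (stable-or-pivotal s k)

      module ReturnAfterSix (s : ℕ)
        (c₂ : R (2 ℕ.+ s) zero ≡ false) (c₃ : R (3 ℕ.+ s) zero ≡ true) (c₄ : R (4 ℕ.+ s) zero ≡ true)
        (c₅ : R (5 ℕ.+ s) zero ≡ false) (c₆ : R (6 ℕ.+ s) zero ≡ true) where

        W : ℕ → Config
        W j = R (j ℕ.+ s)

        W₃⊆W₁ : W 3 ⊆′ W 1
        W₃⊆W₁ = shrinks-when-v₁-off (1 ℕ.+ s) c₂

        W₂⊆W₄ : W 2 ⊆′ W 4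
        W₂⊆W₄ = grows-when-v₁-on (2 ℕ.+ s) c₃

        W₃⊆W₅ : W 3 ⊆′ W 5
        W₃⊆W₅ = grows-when-v₁-on (3 ℕ.+ s) c₄

        W₆⊆W₄ : W 6 ⊆′ W 4
        W₆⊆W₄ = shrinks-when-v₁-off (4 ℕ.+ s) c₅

        W₅⊆W₇ : W 5 ⊆′ W 7
        W₅⊆W₇ = grows-when-v₁-on (5 ℕ.+ s) c₆

        W₁⊆W₅ : W 1 ⊆′ W 5
        W₁⊆W₅ = mk⊆′ λ k on → [ (λ stable → ⊆′-apply W₃⊆W₅ k (trans stable on))
                               , (λ p → pivotal-up p W₂⊆W₄ c₄) ]′ (stable-or-pivotal (1 ℕ.+ s) k)

        W₇⊆W₅ : W 7 ⊆′ W 5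
        W₇⊆W₅ = mk⊆′ λ k on → [ (λ stable → trans (sym stable) on)
                               , (λ p → pivotal-up p W₆⊆W₄ c₄) ]′ (stable-or-pivotal (5 ℕ.+ s) k)

        v₁-tight : votes′ (W 5) zero < 1ℤ + votes′ (W 1) zero
        v₁-tight = begin-strict
          votes′ (W 5) zero        ≡⟨ votes-when-off (W 5) zero c₅ ⟨
          votes (W 5) zero         <⟨ step-v₁-on (W 5) c₆ ⟩
          r zero                   ≤⟨ step-v₁-off (W 1) c₂ ⟩
          votes (W 1) zero         ≤⟨ votes≤1+votes′ (W 1) zero ⟩
          1ℤ + votes′ (W 1) zero   ∎
          where open ≤-Reasoning

        loop∧c₁ : adj G zero zero ≡ true × W 1 zero ≡ true
        loop∧c₁ = v₁-counted (W 1) zero (begin-strict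
          votes′ (W 1) zero        ≤⟨ votes′-mono W₁⊆W₅ zero ⟩
          votes′ (W 5) zero        ≡⟨ votes-when-off (W 5) zero c₅ ⟨
          votes (W 5) zero         <⟨ step-v₁-on (W 5) c₆ ⟩
          r zero                   ≤⟨ step-v₁-off (W 1) c₂ ⟩
          votes (W 1) zero         ∎)
          where open ≤-Reasoning

        W₅⊆W₁ : W 5 ⊆′ W 1
        W₅⊆W₁ = mk⊆′ λ k on →
          [ (λ stable → ⊆′-apply W₃⊆W₁ k (trans (sym stable) on))
          , (λ p → ⊆′-tight W₁⊆W₅ zero v₁-tight k (trans (Graph.sym G zero (suc k)) (proj₁ p)) on)
          ]′ (stable-or-pivotal (3 ℕ.+ s) k)

        W₅⊆W₁-everywhere : W 5 ⊆ W 1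
        W₅⊆W₁-everywhere zero    on = contradiction (trans (sym on) c₅) true≢false
        W₅⊆W₁-everywhere (suc k) on = ⊆′-apply W₅⊆W₁ k on

        W₆⊆W₂ : W 6 ⊆′ W 2
        W₆⊆W₂ = step-mono W₅⊆W₁-everywhere

        -- If v₁ were off at time 7, then W 0 ≐ W 2, hence W 1 ≐ W 3, which c₂ and c₄ forbid.
        module _ (c₇ : W 7 zero ≡ false) where

          v₁-tight′ : votes′ (W 2) zero < 1ℤ + votes′ (W 6) zero
          v₁-tight′ = begin-strict
            votes′ (W 2) zero        ≡⟨ votes-when-off (W 2) zero c₂ ⟨
            votes (W 2) zero         <⟨ step-v₁-on (W 2) c₃ ⟩
            r zero                   ≤⟨ step-v₁-off (W 6) c₇ ⟩
            votes (W 6) zero         ≤⟨ votes≤1+votes′ (W 6) zero ⟩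
            1ℤ + votes′ (W 6) zero   ∎
            where open ≤-Reasoning

          W₂≐′W₀ : ∀ k → W 2 (suc k) ≡ W 0 (suc k)
          W₂≐′W₀ k = [ (λ stable → stable) , (λ p → contradiction
            (⊆′-tight W₆⊆W₂ zero v₁-tight′ k (trans (Graph.sym G zero (suc k)) (proj₁ p))
                      (trans (pivotal-follows-v₁ p) (proj₂ loop∧c₁)))
            (λ on → true≢false (trans (sym on) (pivotal-down p W₅⊆W₁ c₅)))) ]′ (stable-or-pivotal s k)

          c₀ : W 0 zero ≡ false
          c₀ = ¬-not λ c₀-on → <⇒≱ (step-v₁-on (W 0) (proj₂ loop∧c₁)) (begin
            r zero                   ≤⟨ step-v₁-off (W 6) c₇ ⟩
            votes (W 6) zero         ≤⟨ votes≤1+votes′ (W 6) zero ⟩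
            1ℤ + votes′ (W 6) zero   ≤⟨ +-monoʳ-≤ 1ℤ (votes′-mono W₆⊆W₂ zero) ⟩
            1ℤ + votes′ (W 2) zero   ≡⟨ cong (_+_ 1ℤ) (votes′-cong {W 2} {W 0} W₂≐′W₀ zero) ⟩
            1ℤ + votes′ (W 0) zero   ≡⟨ votes-when-on (W 0) zero (proj₁ loop∧c₁) c₀-on ⟨
            votes (W 0) zero         ∎)
            where open ≤-Reasoning

          W₀≐W₂ : W 0 ≐ W 2
          W₀≐W₂ zero    = trans c₀ (sym c₂)
          W₀≐W₂ (suc k) = sym (W₂≐′W₀ k)

          c₇-off-impossible : ⊥
          c₇-off-impossible = <⇒≱ (step-v₁-on (W 3) c₄) (begin
            r zero             ≤⟨ step-v₁-off (W 1) c₂ ⟩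
            votes (W 1) zero   ≡⟨ votes-cong (step-cong W₀≐W₂) zero ⟩
            votes (W 3) zero   ∎)
            where open ≤-Reasoning

        returns : W 7 ≐ W 1
        returns zero    = trans (¬-not c₇-off-impossible) (sym (proj₂ loop∧c₁))
        returns (suc k) = ⊆′-antisym (⊆′-trans W₇⊆W₅ W₅⊆W₁) (⊆′-trans W₁⊆W₅ W₅⊆W₇) k

      R-shift : ∀ t k → R (suc k ℕ.+ (t ℕ.+ q)) ≐ R (t ℕ.+ k)
      R-shift t k i = trans (cong (λ m → R m i) (arith t k q)) (R-periodic (t ℕ.+ k) i)
        where
        arith : ∀ t k q → suc k ℕ.+ (t ℕ.+ q) ≡ suc q ℕ.+ (t ℕ.+ k)
        arith = ℕ-solve-∀

      -- The window starts at s = t + q ≡ t − 1 modulo the period, so that W 0 exists.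
      return-after-six : ∀ t → R (t ℕ.+ 1) zero ≡ false → R (t ℕ.+ 2) zero ≡ true → R (t ℕ.+ 3) zero ≡ true →
                         R (t ℕ.+ 4) zero ≡ false → R (t ℕ.+ 5) zero ≡ true → R (t ℕ.+ 6) ≐ R t
      return-after-six t c₁ c₂ c₃ c₄ c₅ i = begin
        R (t ℕ.+ 6) i   ≡⟨ R-shift t 6 i ⟨
        W 7 i           ≡⟨ returns i ⟩
        W 1 i           ≡⟨ R-shift t 0 i ⟩
        R (t ℕ.+ 0) i   ≡⟨ cong (λ m → R m i) (ℕ.+-identityʳ t) ⟩
        R t i           ∎
        where
        open ≡-Reasoning
        shifted : ∀ k {b} → R (t ℕ.+ k) zero ≡ b → R (suc k ℕ.+ (t ℕ.+ q)) zero ≡ b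
        shifted k = trans (R-shift t k zero)
        open ReturnAfterSix (t ℕ.+ q) (shifted 1 c₁) (shifted 2 c₂) (shifted 3 c₃) (shifted 4 c₄) (shifted 5 c₅)

  module Complement {n : ℕ} (G : Graph (suc n)) (r : Fin (suc n) → ℤ) where

    degree : Fin (suc n) → ℤ
    degree i = ∑[ j < suc n ] 𝟙 (adj G i j)

    r̄ : Fin (suc n) → ℤ
    r̄ i = 1ℤ + (degree i - r i)

    count+count-complement : ∀ U i → + count G U i + + count G (not ∘ U) i ≡ degree i
    count+count-complement U i = begin
      + count G U i + + count G (not ∘ U) i
        ≡⟨ cong₂ _+_ (length-filter-tabulate (λ j → j) (λ j → adj G i j ∧ U j))
                     (length-filter-tabulate (λ j → j) (λ j → adj G i j ∧ not (U j))) ⟩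
      ∑[ j < suc n ] 𝟙 (adj G i j ∧ U j) + ∑[ j < suc n ] 𝟙 (adj G i j ∧ not (U j))
        ≡⟨ ∑-distrib-+ (λ j → 𝟙 (adj G i j ∧ U j)) (λ j → 𝟙 (adj G i j ∧ not (U j))) ⟨
      ∑[ j < suc n ] (𝟙 (adj G i j ∧ U j) + 𝟙 (adj G i j ∧ not (U j)))
        ≡⟨ sum-cong-≗ (λ j → 𝟙-∧-split (adj G i j) (U j)) ⟩
      degree i
        ∎
      where open ≡-Reasoning

    count-complement : ∀ U i → + count G (not ∘ U) i ≡ degree i - + count G U i
    count-complement U i = trans (identity (+ count G (not ∘ U) i) (+ count G U i))
                                 (cong (_- + count G U i) (count+count-complement U i))
      where
      identity : ∀ x y → x ≡ (y + x) - y
      identity = solve-∀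

    step-complement : ∀ U → step G r̄ (not ∘ U) ≐ (not ∘ step G r U)
    step-complement U zero =
      ⌊⌋-complement (+ count G (not ∘ U) zero <? r̄ zero) (+ count G U zero <? r zero)
        (λ below c<r → <⇒≱ (subst (_< r̄ zero) (count-complement U zero) below)
                           (reversed-< (degree zero) c<r))
        (λ c≮r → subst (_< r̄ zero) (sym (count-complement U zero)) (reversed-≤ (degree zero) (≮⇒≥ c≮r)))
    step-complement U (suc k) =
      ⌊⌋-complement (r̄ (suc k) ≤? + count G (not ∘ U) (suc k)) (r (suc k) ≤? + count G U (suc k))
        (λ above r≤c → <⇒≱ (reversed-≤ (degree (suc k)) r≤c)
                           (subst (r̄ (suc k) ≤_) (count-complement U (suc k)) above))
        (λ r≰c → subst (r̄ (suc k) ≤_) (sym (count-complement U (suc k))) (reversed-< (degree (suc k)) (≰⇒> r≰c)))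

    run-complement : ∀ U s → run G r̄ (not ∘ U) s ≐ (not ∘ run G r U s)
    run-complement U ℕ.zero  i = refl
    run-complement U (suc s) i =
      trans (Network.step-cong G r̄ (run-complement U s) i) (step-complement (run G r U s) i)

    recurrent-complement : ∀ U p → run G r U p ≐ U → run G r̄ (not ∘ U) p ≐ (not ∘ U)
    recurrent-complement U p recurrent i = trans (run-complement U p i) (cong not (recurrent i))

open ContrarianDynamics using (module Network; module Complement)
open import Data.Nat using (ℕ; suc; _+_; _≥_)
open import Data.Integer using (ℤ)

lemma8 : ∀ {n} (G : Graph (suc n)) (r : Fin (suc n) → ℤ) (U0 : State (suc n))
         → (Σ ℕ λ p → (p ≥ 1) × (run G r U0 p ≐ U0))
         → (x : Bool) (t : ℕ)
         → run G r U0 (t + 1) zero ≡ not x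
         → run G r U0 (t + 2) zero ≡ x
         → run G r U0 (t + 3) zero ≡ x
         → run G r U0 (t + 4) zero ≡ not x
         → run G r U0 (t + 5) zero ≡ x
         → run G r U0 (t + 6) ≐ run G r U0 t
lemma8 G r U0 (suc q , _ , recurrent) true t = Network.Recurrent.return-after-six G r U0 q recurrent t
lemma8 G r U0 (suc q , _ , recurrent) false t c₁ c₂ c₃ c₄ c₅ i = not-injective (begin
  not (run G r U0 (t + 6) i)       ≡⟨ run-complement U0 (t + 6) i ⟨
  run G r̄ (not ∘ U0) (t + 6) i     ≡⟨ Network.Recurrent.return-after-six G r̄ (not ∘ U0) q
                                        (recurrent-complement U0 (suc q) recurrent) t
                                        (flipped 1 c₁) (flipped 2 c₂) (flipped 3 c₃) (flipped 4 c₄) (flipped 5 c₅) i ⟩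
  run G r̄ (not ∘ U0) t i           ≡⟨ run-complement U0 t i ⟩
  not (run G r U0 t i)             ∎)
  where
  open ≡-Reasoning
  open Complement G r
  flipped : ∀ k {b} → run G r U0 (t + k) zero ≡ b → run G r̄ (not ∘ U0) (t + k) zero ≡ not b
  flipped k c = trans (run-complement U0 (t + k) zero) (cong not c)
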